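{- The Euler characteristic $\chi$ is a ring homomorphism from the strong ring $(\mathcal{G},\oplus,\boxtimes)$ to $\mathbb{Z}$: $\chi(0)=0$, $\chi(K_1)=1$, $\chi(X\oplus Y)=\chi(X)+\chi(Y)$ and $\chi(X\boxtimes Y)=\chi(X)\chi(Y)$ for all $X,Y\in\mathcal{G}$.
   Context: Graphs are finite simple graphs up to isomorphism. $G\oplus H$ denotes the disjoint union. The strong product $G\boxtimes H$ of $G=(V,E)$, $H=(W,F)$ has vertex set $V\times W$, distinct $(a,b),(c,d)$ being adjacent iff ($a=c$ and $\{b,d\}\in F$) or ($b=d$ and $\{a,c\}\in E$) or ($\{a,c\}\in E$ and $\{b,d\}\in F$). The strong ring $\mathcal{G}$ consists of formal differences $A-B$ of graphs (Grothendieck group of the monoid of graphs under $\oplus$ with zero the empty graph: $A-B=C-D$ iff $A\oplus D\oplus K\cong B\oplus C\oplus K$ for some graph $K$), with $\boxtimes$ extended bilinearly and one element $K_1$. For a graph $G$, $\chi(G)=\sum_{k\ge 0}(-1)^k v_k(G)$, where $v_k(G)$ is the number of complete subgraphs of $G$ with $k+1$ vertices; it is extended by $\chi(A-B)=\chi(A)-\chi(B)$. -}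

module Defs where

open import Data.Bool using (Bool; true; false; _∧_; _∨_; not; if_then_else_)
open import Data.Nat using (ℕ; zero; suc; _≡ᵇ_) renaming (_+_ to _+ℕ_; _*_ to _*ℕ_)
open import Data.Integer using (ℤ; +_; -_) renaming (_+_ to _+ℤ_; _*_ to _*ℤ_; _-_ to _-ℤ_)
open import Data.Fin using (Fin; splitAt; remQuot; _≟_)
open import Data.Vec using (Vec; []; _∷_; lookup)
open import Data.List using (List; []; _∷_; _++_; map; allFin)
open import Data.Sum using (_⊎_; inj₁; inj₂)
open import Data.Product using (_×_; _,_; Σ)
open import Relation.Nullary using (yes; no)
open import Relation.Nullary.Decidable using (⌊_⌋)
open import Relation.Binary.PropositionalEquality using (_≡_; refl; sym; cong)
open import Function.Bundles using (_↔_; Inverse)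

record Graph : Set where
  field
    size   : ℕ
    adj    : Fin size → Fin size → Bool
    irrefl : ∀ i → adj i i ≡ false
    symm   : ∀ i j → adj i j ≡ adj j i
open Graph public

record Iso (G H : Graph) : Set where
  field
    bij      : Fin (size G) ↔ Fin (size H)
    preserve : ∀ i j → adj G i j ≡ adj H (Inverse.to bij i) (Inverse.to bij j)

emptyG : Graph
emptyG = record { size = 0 ; adj = λ () ; irrefl = λ () ; symm = λ () }

K₁ : Graph
K₁ = record { size = 1 ; adj = λ _ _ → false ; irrefl = λ _ → refl ; symm = λ _ _ → refl }

module _ {n m : ℕ} (a : Fin n → Fin n → Bool) (b : Fin m → Fin m → Bool) where
  sumAdj : Fin n ⊎ Fin m → Fin n ⊎ Fin m → Bool
  sumAdj (inj₁ x) (inj₁ y) = a x y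
  sumAdj (inj₁ x) (inj₂ y) = false
  sumAdj (inj₂ x) (inj₁ y) = false
  sumAdj (inj₂ x) (inj₂ y) = b x y

sumAdj-irrefl : (G H : Graph) → ∀ x → sumAdj (adj G) (adj H) x x ≡ false
sumAdj-irrefl G H (inj₁ x) = irrefl G x
sumAdj-irrefl G H (inj₂ x) = irrefl H x

sumAdj-sym : (G H : Graph) → ∀ x y →
  sumAdj (adj G) (adj H) x y ≡ sumAdj (adj G) (adj H) y x
sumAdj-sym G H (inj₁ x) (inj₁ y) = symm G x y
sumAdj-sym G H (inj₁ x) (inj₂ y) = refl
sumAdj-sym G H (inj₂ x) (inj₁ y) = refl
sumAdj-sym G H (inj₂ x) (inj₂ y) = symm H x y

infixl 6 _⊕_
_⊕_ : Graph → Graph → Graph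
G ⊕ H = record
  { size   = size G +ℕ size H
  ; adj    = λ i j → sumAdj (adj G) (adj H) (splitAt (size G) i) (splitAt (size G) j)
  ; irrefl = λ i → sumAdj-irrefl G H (splitAt (size G) i)
  ; symm   = λ i j → sumAdj-sym G H (splitAt (size G) i) (splitAt (size G) j)
  }

eqᵇ : ∀ {n} → Fin n → Fin n → Bool
eqᵇ x y = ⌊ x ≟ y ⌋

eqᵇ-refl : ∀ {n} (x : Fin n) → eqᵇ x x ≡ true
eqᵇ-refl x with x ≟ x
... | yes _ = refl
... | no ¬p = Data.Empty.⊥-elim (¬p refl)
  where import Data.Empty

eqᵇ-sym : ∀ {n} (x y : Fin n) → eqᵇ x y ≡ eqᵇ y x
eqᵇ-sym x y with x ≟ y | y ≟ x
... | yes _ | yes _ = refl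
... | no _  | no _  = refl
... | yes p | no ¬q = Data.Empty.⊥-elim (¬q (sym p))
  where import Data.Empty
... | no ¬p | yes q = Data.Empty.⊥-elim (¬p (sym q))
  where import Data.Empty

module _ {n m : ℕ} (a : Fin n → Fin n → Bool) (b : Fin m → Fin m → Bool) where
  prodAdj : Fin n × Fin m → Fin n × Fin m → Bool
  prodAdj (x , y) (x' , y') =
    not (eqᵇ x x' ∧ eqᵇ y y') ∧ ((eqᵇ x x' ∨ a x x') ∧ (eqᵇ y y' ∨ b y y'))

prodAdj-irrefl : (G H : Graph) → ∀ p → prodAdj (adj G) (adj H) p p ≡ false
prodAdj-irrefl G H (x , y) rewrite eqᵇ-refl x | eqᵇ-refl y = refl

prodAdj-sym : (G H : Graph) → ∀ p q →
  prodAdj (adj G) (adj H) p q ≡ prodAdj (adj G) (adj H) q p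
prodAdj-sym G H (x , y) (x' , y')
  rewrite eqᵇ-sym x x' | eqᵇ-sym y y' | symm G x x' | symm H y y' = refl

infixl 7 _⊠_
_⊠_ : Graph → Graph → Graph
G ⊠ H = record
  { size   = size G *ℕ size H
  ; adj    = λ i j → prodAdj (adj G) (adj H) (remQuot (size H) i) (remQuot (size H) j)
  ; irrefl = λ i → prodAdj-irrefl G H (remQuot (size H) i)
  ; symm   = λ i j → prodAdj-sym G H (remQuot (size H) i) (remQuot (size H) j)
  }

-- Euler characteristic of a graph: χ(G) = Σ_k (-1)^k v_k(G), where
-- v_k(G) = number of complete subgraphs with k+1 vertices
-- (= vertex subsets of cardinality k+1 that are cliques).

subsets : (n : ℕ) → List (Vec Bool n)
subsets zero    = [] ∷ []
subsets (suc n) = map (true ∷_) (subsets n) ++ map (false ∷_) (subsets n)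

card : ∀ {n} → Vec Bool n → ℕ
card []          = 0
card (true ∷ s)  = suc (card s)
card (false ∷ s) = card s

allᵇ : ∀ {A : Set} → (A → Bool) → List A → Bool
allᵇ p []       = true
allᵇ p (x ∷ xs) = p x ∧ allᵇ p xs

isClique : (G : Graph) → Vec Bool (size G) → Bool
isClique G s =
  allᵇ (λ i → allᵇ (λ j →
    if lookup s i ∧ lookup s j ∧ not (eqᵇ i j) then adj G i j else true)
    (allFin (size G))) (allFin (size G))

countᵇ : ∀ {A : Set} → (A → Bool) → List A → ℕ
countᵇ p []       = 0
countᵇ p (x ∷ xs) = if p x then suc (countᵇ p xs) else countᵇ p xs

v : ℕ → Graph → ℕ
v k G = countᵇ (λ s → isClique G s ∧ (card s ≡ᵇ suc k)) (subsets (size G))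

sign : ℕ → ℤ
sign zero    = + 1
sign (suc k) = - sign k

partialχ : Graph → ℕ → ℤ
partialχ G zero    = + 0
partialχ G (suc k) = partialχ G k +ℤ sign k *ℤ (+ v k G)

-- v_k(G) = 0 for k ≥ size G, so summing k = 0 … size G is the full sum
χG : Graph → ℤ
χG G = partialχ G (suc (size G))

-- The strong ring: formal differences A - B, represented by pairs (A , B)

SR : Set
SR = Graph × Graph

_≈SR_ : SR → SR → Set
(A , B) ≈SR (C , D) = Σ Graph (λ K → Iso (A ⊕ D ⊕ K) (B ⊕ C ⊕ K))

0SR : SR
0SR = emptyG , emptyG

1SR : SR
1SR = K₁ , emptyG

infixl 6 _⊕SR_
_⊕SR_ : SR → SR → SR
(A , B) ⊕SR (C , D) = (A ⊕ C) , (B ⊕ D)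

-- bilinear extension: (A - B)(C - D) = (AC + BD) - (AD + BC)
infixl 7 _⊠SR_
_⊠SR_ : SR → SR → SR
(A , B) ⊠SR (C , D) = (A ⊠ C ⊕ B ⊠ D) , (A ⊠ D ⊕ B ⊠ C)

χ : SR → ℤ
χ (A , B) = χG A -ℤ χG B

-- With W(G) = Σ (-1)^|C| over all cliques C of G, the empty one included, χ(G) = 1 - W(G);
-- so it suffices that W is an isomorphism invariant, W(G ⊕ H) = W(G) + W(H) - 1 and
-- 1 - W(G ⊠ H) = (1 - W(G)) (1 - W(H)).  A clique of G ⊕ H is a clique of G beside a clique
-- of H, one of the two empty.  A set R ⊆ V(G) × V(H) is a clique of G ⊠ H iff both of its
-- projections are cliques, and by inclusion–exclusion the signed number of R with projections
-- exactly A and B is (-1)^|A| [B = ∅] + (-1)^|B| [A = ∅] - (-1)^(|A|+|B|); summing over cliques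
-- A, B gives W(G) + W(H) - W(G) W(H).  On formal differences the rest is ring arithmetic.
module Submission where

open import Defs
open import Data.Bool using (Bool; true; false; _∧_; _∨_; not; T; if_then_else_)
open import Data.Bool.Properties using (T-∧; T-∨; T-≡)
open import Data.Nat as ℕ using (ℕ; zero; suc; _≡ᵇ_; _≤_; _<_; z≤n; s≤s)
open import Data.Nat.Properties using (≡ᵇ⇒≡; ≡⇒≡ᵇ; <⇒≢; <⇒≤; ≤-refl; m≤n⇒m<n∨m≡n; m≤n⇒m≤1+n)
open import Data.Integer using (ℤ; +_; _+_; _*_; -_; _-_; 0ℤ; 1ℤ)
open import Data.Integer.Properties
  using (*-zeroˡ; *-identityˡ; +-identityˡ; +-identityʳ; +-inverseˡ; +-inverseʳ; +-comm; *-comm; *-assoc;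
         neg-distrib-+; neg-distribˡ-*; *-zeroʳ; pos-+; *-distribˡ-+; +-commutativeSemigroup)
open import Data.Integer.Tactic.RingSolver using (solve-∀)
open import Algebra.Properties.CommutativeSemigroup +-commutativeSemigroup using () renaming (interchange to +-interchange)
open import Data.Fin using (Fin; _≟_; remQuot; punchIn; punchOut)
open import Data.Fin.Properties using (+↔⊎; *↔×; combine-remQuot; punchIn-punchOut)
open import Data.Fin.Permutation using (remove)
open import Data.Fin.Subset using (Subset; inside; outside; _∪_) renaming (⊥ to ∅)
open import Data.Fin.Subset.Properties using (∪-assoc; ∪-identityˡ; ∪-identityʳ)
open import Data.List as List using (List; []; _∷_; allFin)
open import Data.List.Membership.Propositional using (_∈_)
open import Data.List.Membership.Propositional.Properties using (∈-allFin)
open import Data.List.Relation.Unary.Any using (here; there)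
open import Data.Vec using (Vec; []; _∷_; _++_; concat; map; lookup; tabulate; insertAt)
open import Data.Vec.Properties using (lookup-splitAt; lookup-concat; lookup-map; lookup-zipWith; lookup-replicate;
         lookup∘tabulate; insertAt-lookup; insertAt-punchIn)
open import Data.Product as Product using (_×_; _,_; ∃-syntax; proj₁; proj₂)
open import Data.Sum as Sum using (_⊎_; inj₁; inj₂; [_,_]′)
open import Data.Sum.Properties using (inj₁-injective; inj₂-injective)
open import Data.Empty using (⊥; ⊥-elim)
open import Data.Unit using (tt)
open import Function using (_∘_; id)
open import Function.Bundles using (_↔_; _⇔_; mk⇔; Inverse; Equivalence)
open import Function.Properties.Equivalence using () renaming (trans to ⇔-trans; sym to ⇔-sym)
open import Data.Product.Function.NonDependent.Propositional using (_×-⇔_)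
open import Relation.Nullary using (¬_; yes; no)
open import Relation.Binary.PropositionalEquality
open ≡-Reasoning

-- Subsets

𝟙 : Bool → ℤ
𝟙 true  = 1ℤ
𝟙 false = 0ℤ

𝟙-∧ : ∀ a b → 𝟙 (a ∧ b) ≡ 𝟙 a * 𝟙 b
𝟙-∧ true  b = sym (*-identityˡ (𝟙 b))
𝟙-∧ false b = refl

𝟙-∨ : ∀ a b → 𝟙 (a ∨ b) ≡ 𝟙 a + 𝟙 b - 𝟙 a * 𝟙 b
𝟙-∨ true  true  = refl
𝟙-∨ true  false = refl
𝟙-∨ false true  = refl
𝟙-∨ false false = refl

T-injective : ∀ {a b : Bool} → T a ⇔ T b → a ≡ b
T-injective {false} {false} _ = refl
T-injective {false} {true}  h = ⊥-elim (Equivalence.from h tt)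
T-injective {true}  {false} h = ⊥-elim (Equivalence.to h tt)
T-injective {true}  {true}  _ = refl

isEmpty : ∀ {n} → Subset n → Bool
isEmpty s = card s ≡ᵇ 0

nonempty : ∀ {n} → Subset n → Bool
nonempty s = not (isEmpty s)

sgn : ∀ {n} → Subset n → ℤ
sgn s = sign (card s)

∅-isEmpty : ∀ n → isEmpty (∅ {n}) ≡ true
∅-isEmpty zero    = refl
∅-isEmpty (suc n) = ∅-isEmpty n

sgn-∅ : ∀ n → sgn (∅ {n}) ≡ 1ℤ
sgn-∅ zero    = refl
sgn-∅ (suc n) = sgn-∅ n

sgn-++ : ∀ {n m} (a : Subset n) (b : Subset m) → sgn (a ++ b) ≡ sgn a * sgn b
sgn-++ []            b = sym (*-identityˡ (sgn b))
sgn-++ (inside ∷ a)  b = trans (cong -_ (sgn-++ a b)) (neg-distribˡ-* (sgn a) (sgn b))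
sgn-++ (outside ∷ a) b = sgn-++ a b

isEmpty⇒∉ : ∀ {n} (s : Subset n) {x} → T (isEmpty s) → ¬ T (lookup s x)
isEmpty⇒∉ (outside ∷ s) {Fin.zero}  e ()
isEmpty⇒∉ (outside ∷ s) {Fin.suc x} e = isEmpty⇒∉ s e

∈⇒nonempty : ∀ {n} (s : Subset n) {x} → T (lookup s x) → T (nonempty s)
∈⇒nonempty (inside ∷ s)  {Fin.zero}  _ = tt
∈⇒nonempty (inside ∷ s)  {Fin.suc x} _ = tt
∈⇒nonempty (outside ∷ s) {Fin.suc x} x∈s = ∈⇒nonempty s x∈s

nonempty⇒∃∈ : ∀ {n} (s : Subset n) → T (nonempty s) → ∃[ x ] T (lookup s x)
nonempty⇒∃∈ (inside ∷ s)  _ = Fin.zero , tt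
nonempty⇒∃∈ (outside ∷ s) h = let x , x∈s = nonempty⇒∃∈ s h in Fin.suc x , x∈s

T-nonempty : ∀ {n} (s : Subset n) → T (nonempty s) ⇔ (∃[ x ] T (lookup s x))
T-nonempty s = mk⇔ (nonempty⇒∃∈ s) (λ (_ , x∈s) → ∈⇒nonempty s x∈s)

emptyOrMember : ∀ {n} (s : Subset n) → T (isEmpty s) ⊎ ∃[ x ] T (lookup s x)
emptyOrMember []            = inj₁ tt
emptyOrMember (inside ∷ s)  = inj₂ (Fin.zero , tt)
emptyOrMember (outside ∷ s) = Sum.map₂ (λ (x , x∈s) → Fin.suc x , x∈s) (emptyOrMember s)

-- Sums over subsets

∑ : (n : ℕ) → (Subset n → ℤ) → ℤ
∑ zero    F = F []
∑ (suc n) F = ∑ n (F ∘ (inside ∷_)) + ∑ n (F ∘ (outside ∷_))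

∑-cong : ∀ n {F G : Subset n → ℤ} → (∀ s → F s ≡ G s) → ∑ n F ≡ ∑ n G
∑-cong zero    F≗G = F≗G []
∑-cong (suc n) F≗G = cong₂ _+_ (∑-cong n (F≗G ∘ (inside ∷_))) (∑-cong n (F≗G ∘ (outside ∷_)))

∑-distrib-+ : ∀ n (F G : Subset n → ℤ) → ∑ n (λ s → F s + G s) ≡ ∑ n F + ∑ n G
∑-distrib-+ zero    F G = refl
∑-distrib-+ (suc n) F G = begin
  ∑ n (λ s → F (inside ∷ s) + G (inside ∷ s)) + ∑ n (λ s → F (outside ∷ s) + G (outside ∷ s))
    ≡⟨ cong₂ _+_ (∑-distrib-+ n _ _) (∑-distrib-+ n _ _) ⟩
  (∑ n Fᵢ + ∑ n Gᵢ) + (∑ n Fₒ + ∑ n Gₒ)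
    ≡⟨ +-interchange (∑ n Fᵢ) (∑ n Gᵢ) (∑ n Fₒ) (∑ n Gₒ) ⟩
  ∑ (suc n) F + ∑ (suc n) G ∎
  where
  Fᵢ = F ∘ (inside ∷_)
  Fₒ = F ∘ (outside ∷_)
  Gᵢ = G ∘ (inside ∷_)
  Gₒ = G ∘ (outside ∷_)

∑-distribˡ-* : ∀ n c (F : Subset n → ℤ) → ∑ n (λ s → c * F s) ≡ c * ∑ n F
∑-distribˡ-* zero    c F = refl
∑-distribˡ-* (suc n) c F =
  trans (cong₂ _+_ (∑-distribˡ-* n c Fᵢ) (∑-distribˡ-* n c Fₒ)) (sym (*-distribˡ-+ c (∑ n Fᵢ) (∑ n Fₒ)))
  where
  Fᵢ = F ∘ (inside ∷_)
  Fₒ = F ∘ (outside ∷_)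

∑-neg : ∀ n (F : Subset n → ℤ) → ∑ n (λ s → - F s) ≡ - ∑ n F
∑-neg zero    F = refl
∑-neg (suc n) F = trans (cong₂ _+_ (∑-neg n Fᵢ) (∑-neg n Fₒ)) (sym (neg-distrib-+ (∑ n Fᵢ) (∑ n Fₒ)))
  where
  Fᵢ = F ∘ (inside ∷_)
  Fₒ = F ∘ (outside ∷_)

∑-zero : ∀ n → ∑ n (λ _ → 0ℤ) ≡ 0ℤ
∑-zero zero    = refl
∑-zero (suc n) = cong₂ _+_ (∑-zero n) (∑-zero n)

∑-linear : ∀ n c d (F G : Subset n → ℤ) → ∑ n (λ s → c * F s + d * G s) ≡ c * ∑ n F + d * ∑ n G
∑-linear n c d F G =
  trans (∑-distrib-+ n (λ s → c * F s) (λ s → d * G s)) (cong₂ _+_ (∑-distribˡ-* n c F) (∑-distribˡ-* n d G))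

∑-++ : ∀ n m (F : Subset (n ℕ.+ m) → ℤ) → ∑ (n ℕ.+ m) F ≡ ∑ n (λ a → ∑ m (λ b → F (a ++ b)))
∑-++ zero    m F = refl
∑-++ (suc n) m F = cong₂ _+_ (∑-++ n m _) (∑-++ n m _)

∑-empty : ∀ n (F : Subset n → ℤ) → ∑ n (λ s → 𝟙 (isEmpty s) * F s) ≡ F ∅
∑-empty zero    F = *-identityˡ (F [])
∑-empty (suc n) F = begin
  ∑ n (λ s → 0ℤ * F (inside ∷ s)) + ∑ n (λ s → 𝟙 (isEmpty s) * F (outside ∷ s))
    ≡⟨ cong₂ _+_ (∑-distribˡ-* n 0ℤ (F ∘ (inside ∷_))) (∑-empty n (F ∘ (outside ∷_))) ⟩
  0ℤ * ∑ n (F ∘ (inside ∷_)) + F ∅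
    ≡⟨ cong (_+ F ∅) (*-zeroˡ (∑ n (F ∘ (inside ∷_)))) ⟩
  0ℤ + F ∅
    ≡⟨ +-identityˡ (F ∅) ⟩
  F ∅ ∎

∑-nonempty : ∀ n (F : Bool → Subset n → ℤ) →
             ∑ n (λ s → F (nonempty s) s) ≡ ∑ n (F true) + (F false ∅ - F true ∅)
∑-nonempty n F = begin
  ∑ n (λ s → F (nonempty s) s)
    ≡⟨ ∑-cong n (λ s → split (isEmpty s) s) ⟩
  ∑ n (λ s → F true s + 𝟙 (isEmpty s) * (F false s - F true s))
    ≡⟨ ∑-distrib-+ n (F true) _ ⟩
  ∑ n (F true) + ∑ n (λ s → 𝟙 (isEmpty s) * (F false s - F true s))
    ≡⟨ cong (_+_ (∑ n (F true))) (∑-empty n (λ s → F false s - F true s)) ⟩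
  ∑ n (F true) + (F false ∅ - F true ∅) ∎
  where
  split : ∀ e s → F (not e) s ≡ F true s + 𝟙 e * (F false s - F true s)
  split true  s = add-difference (F false s) (F true s)
    where add-difference : ∀ a b → a ≡ b + 1ℤ * (a - b)
          add-difference = solve-∀
  split false s = sym (trans (cong (_+_ (F true s)) (*-zeroˡ (F false s - F true s))) (+-identityʳ (F true s)))

relabel : ∀ {n m} → Fin n ↔ Fin m → Subset n → Subset m
relabel σ s = tabulate (lookup s ∘ Inverse.from σ)

subset-ext : ∀ {n} (s t : Subset n) → (∀ i → lookup s i ≡ lookup t i) → s ≡ t
subset-ext []      []      _   = refl
subset-ext (b ∷ s) (c ∷ t) s≗t = cong₂ _∷_ (s≗t Fin.zero) (subset-ext s t (s≗t ∘ Fin.suc))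

∑-insertAt : ∀ m (k : Fin (suc m)) (F : Subset (suc m) → ℤ) →
  ∑ (suc m) F ≡ ∑ m (λ t → F (insertAt t k inside)) + ∑ m (λ t → F (insertAt t k outside))
∑-insertAt m       Fin.zero    F = refl
∑-insertAt (suc m) (Fin.suc k) F = begin
  ∑ (suc m) (F ∘ (inside ∷_)) + ∑ (suc m) (F ∘ (outside ∷_))
    ≡⟨ cong₂ _+_ (∑-insertAt m k (F ∘ (inside ∷_))) (∑-insertAt m k (F ∘ (outside ∷_))) ⟩
  (∑ m (F′ inside inside) + ∑ m (F′ inside outside)) + (∑ m (F′ outside inside) + ∑ m (F′ outside outside))
    ≡⟨ +-interchange (∑ m (F′ inside inside)) (∑ m (F′ inside outside))
                     (∑ m (F′ outside inside)) (∑ m (F′ outside outside)) ⟩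
  ∑ (suc m) (λ t → F (insertAt t (Fin.suc k) inside)) + ∑ (suc m) (λ t → F (insertAt t (Fin.suc k) outside)) ∎
  where
  F′ : Bool → Bool → Subset m → ℤ
  F′ b c t = F (b ∷ insertAt t k c)

sgn-insertAt : ∀ {m} (t : Subset m) k b → sgn (insertAt t k b) ≡ sgn (b ∷ t)
sgn-insertAt t             Fin.zero    b       = refl
sgn-insertAt (inside ∷ t)  (Fin.suc k) inside  = cong -_ (sgn-insertAt t k inside)
sgn-insertAt (inside ∷ t)  (Fin.suc k) outside = cong -_ (sgn-insertAt t k outside)
sgn-insertAt (outside ∷ t) (Fin.suc k) inside  = sgn-insertAt t k inside
sgn-insertAt (outside ∷ t) (Fin.suc k) outside = sgn-insertAt t k outside

module RelabelSuc {n m : ℕ} (σ : Fin (suc n) ↔ Fin (suc m)) where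
  k : Fin (suc m)
  k = Inverse.to σ Fin.zero

  σ⁻ : Fin n ↔ Fin m
  σ⁻ = remove Fin.zero σ

  relabel-∷ : ∀ b t → relabel σ (b ∷ t) ≡ insertAt (relabel σ⁻ t) k b
  relabel-∷ b t = subset-ext _ _ pointwise
    where
    pointwise : ∀ j → lookup (relabel σ (b ∷ t)) j ≡ lookup (insertAt (relabel σ⁻ t) k b) j
    pointwise j with k ≟ j
    ... | yes refl = begin
      lookup (relabel σ (b ∷ t)) k          ≡⟨ lookup∘tabulate (lookup (b ∷ t) ∘ Inverse.from σ) k ⟩
      lookup (b ∷ t) (Inverse.from σ k)     ≡⟨ cong (lookup (b ∷ t)) (Inverse.strictlyInverseʳ σ Fin.zero) ⟩
      b                                     ≡⟨ sym (insertAt-lookup (relabel σ⁻ t) k b) ⟩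
      lookup (insertAt (relabel σ⁻ t) k b) k ∎
    ... | no k≢j = begin
      lookup (relabel σ (b ∷ t)) j
        ≡⟨ cong (lookup (relabel σ (b ∷ t))) (sym (punchIn-punchOut k≢j)) ⟩
      lookup (relabel σ (b ∷ t)) (punchIn k j′)
        ≡⟨ lookup∘tabulate (lookup (b ∷ t) ∘ Inverse.from σ) (punchIn k j′) ⟩
      lookup (b ∷ t) (Inverse.from σ (punchIn k j′))
        ≡⟨ cong (lookup (b ∷ t)) (sym (punchIn-punchOut {i = Fin.zero} {j = Inverse.from σ (punchIn k j′)} _)) ⟩
      lookup t (Inverse.from σ⁻ j′)
        ≡⟨ sym (lookup∘tabulate (lookup t ∘ Inverse.from σ⁻) j′) ⟩
      lookup (relabel σ⁻ t) j′
        ≡⟨ sym (insertAt-punchIn (relabel σ⁻ t) k b j′) ⟩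
      lookup (insertAt (relabel σ⁻ t) k b) (punchIn k j′)
        ≡⟨ cong (lookup (insertAt (relabel σ⁻ t) k b)) (punchIn-punchOut k≢j) ⟩
      lookup (insertAt (relabel σ⁻ t) k b) j ∎
      where j′ = punchOut k≢j

∑-relabel : ∀ n m (σ : Fin n ↔ Fin m) (F : Subset m → ℤ) → ∑ m F ≡ ∑ n (F ∘ relabel σ)
∑-relabel zero    zero    σ F = refl
∑-relabel zero    (suc m) σ F with () ← Inverse.from σ Fin.zero
∑-relabel (suc n) zero    σ F with () ← Inverse.to σ Fin.zero
∑-relabel (suc n) (suc m) σ F = begin
  ∑ (suc m) F
    ≡⟨ ∑-insertAt m k F ⟩
  ∑ m (λ t → F (insertAt t k inside)) + ∑ m (λ t → F (insertAt t k outside))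
    ≡⟨ cong₂ _+_ (∑-relabel n m σ⁻ _) (∑-relabel n m σ⁻ _) ⟩
  ∑ n (λ t → F (insertAt (relabel σ⁻ t) k inside)) + ∑ n (λ t → F (insertAt (relabel σ⁻ t) k outside))
    ≡⟨ sym (cong₂ _+_ (∑-cong n (cong F ∘ relabel-∷ inside)) (∑-cong n (cong F ∘ relabel-∷ outside))) ⟩
  ∑ (suc n) (F ∘ relabel σ) ∎
  where open RelabelSuc σ

sgn-relabel : ∀ n m (σ : Fin n ↔ Fin m) (s : Subset n) → sgn (relabel σ s) ≡ sgn s
sgn-relabel zero    zero    σ [] = refl
sgn-relabel zero    (suc m) σ s with () ← Inverse.from σ Fin.zero
sgn-relabel (suc n) zero    σ s with () ← Inverse.to σ Fin.zero
sgn-relabel (suc n) (suc m) σ (b ∷ t) = begin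
  sgn (relabel σ (b ∷ t))          ≡⟨ cong sgn (relabel-∷ b t) ⟩
  sgn (insertAt (relabel σ⁻ t) k b) ≡⟨ sgn-insertAt (relabel σ⁻ t) k b ⟩
  sgn (b ∷ relabel σ⁻ t)            ≡⟨ sgn-∷ b ⟩
  sgn (b ∷ t) ∎
  where
  open RelabelSuc σ
  sgn-∷ : ∀ b → sgn (b ∷ relabel σ⁻ t) ≡ sgn (b ∷ t)
  sgn-∷ inside  = cong -_ (sgn-relabel n m σ⁻ t)
  sgn-∷ outside = sgn-relabel n m σ⁻ t

-- Signed sums and relations with prescribed projections

signedSum : (n : ℕ) → (Subset n → ℤ) → ℤ
signedSum n f = ∑ n (λ s → sgn s * f s)

signedSum-inside : ∀ n (h : Subset n → ℤ) → ∑ n (λ s → sgn (inside ∷ s) * h s) ≡ - signedSum n h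
signedSum-inside n h = trans (∑-cong n (λ s → sym (neg-distribˡ-* (sgn s) (h s)))) (∑-neg n (λ s → sgn s * h s))

signedSum-suc : ∀ n (f : Subset (suc n) → ℤ) →
  signedSum (suc n) f ≡ signedSum n (f ∘ (outside ∷_)) - signedSum n (f ∘ (inside ∷_))
signedSum-suc n f = begin
  ∑ n (λ s → sgn (inside ∷ s) * f (inside ∷ s)) + signedSum n (f ∘ (outside ∷_))
    ≡⟨ cong (_+ signedSum n (f ∘ (outside ∷_))) (signedSum-inside n (f ∘ (inside ∷_))) ⟩
  - signedSum n (f ∘ (inside ∷_)) + signedSum n (f ∘ (outside ∷_))
    ≡⟨ +-comm (- signedSum n (f ∘ (inside ∷_))) _ ⟩
  signedSum n (f ∘ (outside ∷_)) - signedSum n (f ∘ (inside ∷_)) ∎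

signedSum-isEmpty : ∀ n → signedSum n (𝟙 ∘ isEmpty) ≡ 1ℤ
signedSum-isEmpty n =
  trans (∑-cong n (λ s → *-comm (sgn s) (𝟙 (isEmpty s)))) (trans (∑-empty n sgn) (sgn-∅ n))

-- For u ≠ ∅, toggling a fixed element of u is a sign-reversing involution on s fixing u ∪ s.
signedSum-∪ : ∀ n (u : Subset n) (g : Subset n → ℤ) →
              signedSum n (λ s → g (u ∪ s)) ≡ 𝟙 (isEmpty u) * signedSum n g
signedSum-∪ zero    []            g = sym (*-identityˡ _)
signedSum-∪ (suc n) (inside ∷ u)  g = begin
  ∑ n (λ s → sgn (inside ∷ s) * g (inside ∷ u ∪ s)) + X
    ≡⟨ cong (_+ X) (signedSum-inside n (λ s → g (inside ∷ u ∪ s))) ⟩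
  - X + X
    ≡⟨ +-inverseˡ X ⟩
  0ℤ ∎
  where X = signedSum n (λ s → g (inside ∷ u ∪ s))
signedSum-∪ (suc n) (outside ∷ u) g = begin
  signedSum (suc n) (λ s → g ((outside ∷ u) ∪ s))
    ≡⟨ signedSum-suc n (λ s → g ((outside ∷ u) ∪ s)) ⟩
  signedSum n (λ s → g (outside ∷ u ∪ s)) - signedSum n (λ s → g (inside ∷ u ∪ s))
    ≡⟨ cong₂ _-_ (signedSum-∪ n u (g ∘ (outside ∷_))) (signedSum-∪ n u (g ∘ (inside ∷_))) ⟩
  𝟙 (isEmpty u) * signedSum n (g ∘ (outside ∷_)) - 𝟙 (isEmpty u) * signedSum n (g ∘ (inside ∷_))
    ≡⟨ factor (𝟙 (isEmpty u)) (signedSum n (g ∘ (outside ∷_))) (signedSum n (g ∘ (inside ∷_))) ⟩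
  𝟙 (isEmpty u) * (signedSum n (g ∘ (outside ∷_)) - signedSum n (g ∘ (inside ∷_)))
    ≡⟨ cong (𝟙 (isEmpty u) *_) (sym (signedSum-suc n g)) ⟩
  𝟙 (isEmpty u) * signedSum (suc n) g ∎
  where
  factor : ∀ c a b → c * a - c * b ≡ c * (a - b)
  factor = solve-∀

-- A subset of Fin n × Fin m is summed over as the n-tuple of its rows.
∑ᴿ : (n m : ℕ) → (Vec (Subset m) n → ℤ) → ℤ
∑ᴿ zero    m F = F []
∑ᴿ (suc n) m F = ∑ m (λ r → ∑ᴿ n m (λ rs → F (r ∷ rs)))

∑ᴿ-cong : ∀ n m {F G : Vec (Subset m) n → ℤ} → (∀ rs → F rs ≡ G rs) → ∑ᴿ n m F ≡ ∑ᴿ n m G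
∑ᴿ-cong zero    m F≗G = F≗G []
∑ᴿ-cong (suc n) m F≗G = ∑-cong m (λ r → ∑ᴿ-cong n m (λ rs → F≗G (r ∷ rs)))

∑ᴿ-distribˡ-* : ∀ n m c (F : Vec (Subset m) n → ℤ) → ∑ᴿ n m (λ rs → c * F rs) ≡ c * ∑ᴿ n m F
∑ᴿ-distribˡ-* zero    m c F = refl
∑ᴿ-distribˡ-* (suc n) m c F =
  trans (∑-cong m (λ r → ∑ᴿ-distribˡ-* n m c (λ rs → F (r ∷ rs))))
        (∑-distribˡ-* m c (λ r → ∑ᴿ n m (λ rs → F (r ∷ rs))))

∑-concat : ∀ n m (F : Subset (n ℕ.* m) → ℤ) → ∑ (n ℕ.* m) F ≡ ∑ᴿ n m (F ∘ concat)
∑-concat zero    m F = refl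
∑-concat (suc n) m F =
  trans (∑-++ m (n ℕ.* m) F) (∑-cong m (λ r → ∑-concat n m (λ t → F (r ++ t))))

support : ∀ {n m} → Vec (Subset m) n → Subset n
support = map nonempty

⋃ : ∀ {n m} → Vec (Subset m) n → Subset m
⋃ []       = ∅
⋃ (r ∷ rs) = r ∪ ⋃ rs

T-lookup-⋃ : ∀ {n m} (rs : Vec (Subset m) n) y → T (lookup (⋃ rs) y) ⇔ (∃[ x ] T (lookup (lookup rs x) y))
T-lookup-⋃ []       y = mk⇔ (λ y∈∅ → ⊥-elim (subst T (lookup-replicate y outside) y∈∅)) (λ ())
T-lookup-⋃ (r ∷ rs) y = ⇔-trans (⇔-trans (mk⇔ (subst T ∪-lookup) (subst T (sym ∪-lookup))) T-∨) (mk⇔ to from)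
  where
  ∪-lookup : lookup (r ∪ ⋃ rs) y ≡ (lookup r y ∨ lookup (⋃ rs) y)
  ∪-lookup = lookup-zipWith _∨_ y r (⋃ rs)
  to : T (lookup r y) ⊎ T (lookup (⋃ rs) y) → ∃[ x ] T (lookup (lookup (r ∷ rs) x) y)
  to (inj₁ y∈r) = Fin.zero , y∈r
  to (inj₂ y∈⋃) = let x , y∈rₓ = Equivalence.to (T-lookup-⋃ rs y) y∈⋃ in Fin.suc x , y∈rₓ
  from : ∃[ x ] T (lookup (lookup (r ∷ rs) x) y) → T (lookup r y) ⊎ T (lookup (⋃ rs) y)
  from (Fin.zero  , y∈r)  = inj₁ y∈r
  from (Fin.suc x , y∈rₓ) = inj₂ (Equivalence.from (T-lookup-⋃ rs y) (x , y∈rₓ))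

signedSum-∪-affine : ∀ m (u : Subset m) a d (g : Subset m → ℤ) →
  signedSum m (λ r → a * g (u ∪ r) - 𝟙 (isEmpty (u ∪ r)) * d) ≡ 𝟙 (isEmpty u) * (a * signedSum m g - d)
signedSum-∪-affine m u a d g = begin
  signedSum m (λ r → a * g (u ∪ r) - 𝟙 (isEmpty (u ∪ r)) * d)
    ≡⟨ signedSum-∪ m u (λ t → a * g t - 𝟙 (isEmpty t) * d) ⟩
  𝟙 (isEmpty u) * ∑ m (λ t → sgn t * (a * g t - 𝟙 (isEmpty t) * d))
    ≡⟨ cong (𝟙 (isEmpty u) *_) (∑-cong m (λ t → expand a d (sgn t) (g t) (𝟙 (isEmpty t)))) ⟩
  𝟙 (isEmpty u) * ∑ m (λ t → a * (sgn t * g t) + (- d) * (sgn t * 𝟙 (isEmpty t)))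
    ≡⟨ cong (𝟙 (isEmpty u) *_) (∑-linear m a (- d) (λ t → sgn t * g t) (λ t → sgn t * 𝟙 (isEmpty t))) ⟩
  𝟙 (isEmpty u) * (a * signedSum m g + (- d) * signedSum m (𝟙 ∘ isEmpty))
    ≡⟨ cong (λ x → 𝟙 (isEmpty u) * (a * signedSum m g + (- d) * x)) (signedSum-isEmpty m) ⟩
  𝟙 (isEmpty u) * (a * signedSum m g + (- d) * 1ℤ)
    ≡⟨ cong (𝟙 (isEmpty u) *_) (tidy (a * signedSum m g) d) ⟩
  𝟙 (isEmpty u) * (a * signedSum m g - d) ∎
  where
  expand : ∀ a d σ x e → σ * (a * x - e * d) ≡ a * (σ * x) + (- d) * (σ * e)
  expand = solve-∀
  tidy : ∀ x y → x + (- y) * 1ℤ ≡ x - y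
  tidy = solve-∀

-- Inclusion–exclusion over the rows; u is the part of the second projection covered by earlier rows.
∑ᴿ-support-⋃ : ∀ n m (f : Subset n → ℤ) (g : Subset m → ℤ) (u : Subset m) →
  ∑ᴿ n m (λ rs → sgn (concat rs) * (f (support rs) * g (u ∪ ⋃ rs)))
  ≡ signedSum n f * g u - 𝟙 (isEmpty u) * ((signedSum n f - f ∅) * signedSum m g)
∑ᴿ-support-⋃ zero m f g u = begin
  1ℤ * (f [] * g (u ∪ ∅))                    ≡⟨ cong (λ t → 1ℤ * (f [] * g t)) (∪-identityʳ u) ⟩
  1ℤ * (f [] * g u)                          ≡⟨ base (f []) (g u) (𝟙 (isEmpty u)) (signedSum m g) ⟩
  1ℤ * f [] * g u - 𝟙 (isEmpty u) * ((1ℤ * f [] - f []) * signedSum m g) ∎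
  where
  base : ∀ a b z S → 1ℤ * (a * b) ≡ 1ℤ * a * b - z * ((1ℤ * a - a) * S)
  base = solve-∀
∑ᴿ-support-⋃ (suc n) m f g u = begin
  ∑ m (λ r → ∑ᴿ n m (λ rs → sgn (r ++ concat rs) * (f (nonempty r ∷ support rs) * g (u ∪ (r ∪ ⋃ rs)))))
    ≡⟨ ∑-cong m (λ r → trans (peel-row r) (cong (sgn r *_) (∑ᴿ-support-⋃ n m (f ∘ (nonempty r ∷_)) g (u ∪ r)))) ⟩
  ∑ m (λ r → F (nonempty r) r)
    ≡⟨ ∑-nonempty m F ⟩
  ∑ m (F true) + (F false ∅ - F true ∅)
    ≡⟨ cong₂ _+_ (signedSum-∪-affine m u (h true) ((h true - f (inside ∷ ∅)) * S) g)
                 (cong₂ _-_ (F-∅ false) (F-∅ true)) ⟩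
  z * (h true * S - (h true - f (inside ∷ ∅)) * S)
    + (1ℤ * (h false * g u - z * ((h false - f ∅) * S)) - 1ℤ * (h true * g u - z * ((h true - f (inside ∷ ∅)) * S)))
    ≡⟨ collect (h true) (h false) z S (g u) (f (inside ∷ ∅)) (f ∅) ⟩
  (h false - h true) * g u - z * (((h false - h true) - f ∅) * S)
    ≡⟨ cong (λ t → t * g u - z * ((t - f ∅) * S)) (sym (signedSum-suc n f)) ⟩
  signedSum (suc n) f * g u - z * ((signedSum (suc n) f - f ∅) * S) ∎
  where
  z = 𝟙 (isEmpty u)
  S = signedSum m g
  h : Bool → ℤ
  h b = signedSum n (f ∘ (b ∷_))
  F : Bool → Subset m → ℤ
  F b r = sgn r * (h b * g (u ∪ r) - 𝟙 (isEmpty (u ∪ r)) * ((h b - f (b ∷ ∅)) * S))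

  peel-row : ∀ r →
    ∑ᴿ n m (λ rs → sgn (r ++ concat rs) * (f (nonempty r ∷ support rs) * g (u ∪ (r ∪ ⋃ rs))))
    ≡ sgn r * ∑ᴿ n m (λ rs → sgn (concat rs) * (f (nonempty r ∷ support rs) * g ((u ∪ r) ∪ ⋃ rs)))
  peel-row r = trans
    (∑ᴿ-cong n m (λ rs → trans
      (cong₂ _*_ (sgn-++ r (concat rs)) (cong (λ t → f (nonempty r ∷ support rs) * g t) (sym (∪-assoc u r (⋃ rs)))))
      (*-assoc (sgn r) (sgn (concat rs)) (f (nonempty r ∷ support rs) * g ((u ∪ r) ∪ ⋃ rs)))))
    (∑ᴿ-distribˡ-* n m (sgn r) (λ rs → sgn (concat rs) * (f (nonempty r ∷ support rs) * g ((u ∪ r) ∪ ⋃ rs))))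

  F-∅ : ∀ b → F b ∅ ≡ 1ℤ * (h b * g u - z * ((h b - f (b ∷ ∅)) * S))
  F-∅ b rewrite ∪-identityʳ u | sgn-∅ m = refl

  collect : ∀ a b z S G p q →
    z * (a * S - (a - p) * S) + (1ℤ * (b * G - z * ((b - q) * S)) - 1ℤ * (a * G - z * ((a - p) * S)))
    ≡ (b - a) * G - z * (((b - a) - q) * S)
  collect = solve-∀

-- Cliques

CliqueOn : ∀ {A : Set} → (A → Bool) → (A → A → Bool) → Set
CliqueOn s E = ∀ x y → T (s x) → T (s y) → x ≡ y ⊎ T (E x y)

IsClique : (G : Graph) → Subset (size G) → Set
IsClique G s = CliqueOn (lookup s) (adj G)

T-allᵇ : ∀ {A : Set} (p : A → Bool) xs → T (allᵇ p xs) ⇔ (∀ {x} → x ∈ xs → T (p x))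
T-allᵇ p []       = mk⇔ (λ _ ()) _
T-allᵇ p (x ∷ xs) = mk⇔ to from
  where
  to : T (p x ∧ allᵇ p xs) → ∀ {y} → y ∈ x ∷ xs → T (p y)
  to h (here refl) = proj₁ (Equivalence.to T-∧ h)
  to h (there y∈xs) = Equivalence.to (T-allᵇ p xs) (proj₂ (Equivalence.to T-∧ h)) y∈xs
  from : (∀ {y} → y ∈ x ∷ xs → T (p y)) → T (p x ∧ allᵇ p xs)
  from h = Equivalence.from T-∧ (h (here refl) , Equivalence.from (T-allᵇ p xs) (h ∘ there))

T-allᵇ-allFin : ∀ n (p : Fin n → Bool) → T (allᵇ p (allFin n)) ⇔ (∀ i → T (p i))
T-allᵇ-allFin n p = mk⇔ (λ h i → Equivalence.to (T-allᵇ p (allFin n)) h (∈-allFin i))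
                        (λ h → Equivalence.from (T-allᵇ p (allFin n)) (λ {i} _ → h i))

T-adjacentIfDistinct : ∀ {n} (a b : Bool) (i j : Fin n) e →
  T (if a ∧ b ∧ not (eqᵇ i j) then e else true) ⇔ (T a → T b → i ≡ j ⊎ T e)
T-adjacentIfDistinct false b     i j e = mk⇔ (λ _ ()) _
T-adjacentIfDistinct true  false i j e = mk⇔ (λ _ _ ()) _
T-adjacentIfDistinct true  true  i j e with i ≟ j
... | yes i≡j = mk⇔ (λ _ _ _ → inj₁ i≡j) _
... | no  i≢j = mk⇔ (λ h _ _ → inj₂ h) (λ h → [ ⊥-elim ∘ i≢j , id ]′ (h tt tt))

isClique-reflects : ∀ G s → T (isClique G s) ⇔ IsClique G s
isClique-reflects G s = mk⇔ to from
  where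
  n = size G
  condition : Fin n → Fin n → Bool
  condition i j = if lookup s i ∧ lookup s j ∧ not (eqᵇ i j) then adj G i j else true
  to : T (isClique G s) → IsClique G s
  to h i j = Equivalence.to (T-adjacentIfDistinct (lookup s i) (lookup s j) i j (adj G i j))
    (Equivalence.to (T-allᵇ-allFin n (condition i)) (Equivalence.to (T-allᵇ-allFin n _) h i) j)
  from : IsClique G s → T (isClique G s)
  from h = Equivalence.from (T-allᵇ-allFin n _) λ i → Equivalence.from (T-allᵇ-allFin n (condition i)) λ j →
    Equivalence.from (T-adjacentIfDistinct (lookup s i) (lookup s j) i j (adj G i j)) (h i j)

∅-isClique : ∀ G → isClique G ∅ ≡ true
∅-isClique G = T-injective (mk⇔ (λ _ → tt) λ _ → Equivalence.from (isClique-reflects G ∅) empty-clique)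
  where
  empty-clique : IsClique G ∅
  empty-clique x y x∈∅ _ = ⊥-elim (subst T (lookup-replicate x outside) x∈∅)

CliqueOn-↔ : ∀ {A B : Set} (e : A ↔ B) {s : A → Bool} {E : A → A → Bool}
                                        {s′ : B → Bool} {E′ : B → B → Bool} →
  (∀ x → s x ≡ s′ (Inverse.to e x)) → (∀ x y → E x y ≡ E′ (Inverse.to e x) (Inverse.to e y)) →
  CliqueOn s E ⇔ CliqueOn s′ E′
CliqueOn-↔ e {s} {E} {s′} {E′} s≡ E≡ = mk⇔ to from
  where
  open Inverse e using () renaming (to to f; from to f⁻¹)
  f∘f⁻¹ = Inverse.strictlyInverseˡ e
  f⁻¹∘f = Inverse.strictlyInverseʳ e
  f-injective : ∀ {x y} → f x ≡ f y → x ≡ y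
  f-injective {x} {y} eq = trans (sym (f⁻¹∘f x)) (trans (cong f⁻¹ eq) (f⁻¹∘f y))
  to : CliqueOn s E → CliqueOn s′ E′
  to h a b sa sb with h (f⁻¹ a) (f⁻¹ b) (subst T (sym (trans (s≡ (f⁻¹ a)) (cong s′ (f∘f⁻¹ a)))) sa)
                                            (subst T (sym (trans (s≡ (f⁻¹ b)) (cong s′ (f∘f⁻¹ b)))) sb)
  ... | inj₁ eq = inj₁ (trans (sym (f∘f⁻¹ a)) (trans (cong f eq) (f∘f⁻¹ b)))
  ... | inj₂ adj = inj₂ (subst T (trans (E≡ (f⁻¹ a) (f⁻¹ b)) (cong₂ E′ (f∘f⁻¹ a) (f∘f⁻¹ b))) adj)
  from : CliqueOn s′ E′ → CliqueOn s E
  from h x y sx sy with h (f x) (f y) (subst T (s≡ x) sx) (subst T (s≡ y) sy)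
  ... | inj₁ eq = inj₁ (f-injective eq)
  ... | inj₂ adj = inj₂ (subst T (sym (E≡ x y)) adj)

isClique-relabel : ∀ {G H} (iso : Iso G H) s → isClique H (relabel (Iso.bij iso) s) ≡ isClique G s
isClique-relabel {G} {H} iso s = T-injective
  (⇔-trans (isClique-reflects H (relabel σ s))
  (⇔-sym (⇔-trans (isClique-reflects G s) (CliqueOn-↔ σ lookup-relabel (Iso.preserve iso)))))
  where
  σ = Iso.bij iso
  lookup-relabel : ∀ x → lookup s x ≡ lookup (relabel σ s) (Inverse.to σ x)
  lookup-relabel x = sym (trans (lookup∘tabulate _ (Inverse.to σ x)) (cong (lookup s) (Inverse.strictlyInverseʳ σ x)))

Apart : ∀ {A B : Set} → (A → Bool) → (B → Bool) → Set
Apart sa sb = ∀ x y → T (sa x) → T (sb y) → ⊥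

CliqueOn-⊎ : ∀ {n m} (sa : Fin n → Bool) (sb : Fin m → Bool) EA EB →
  CliqueOn [ sa , sb ]′ (sumAdj EA EB) ⇔ (CliqueOn sa EA × CliqueOn sb EB × Apart sa sb)
CliqueOn-⊎ sa sb EA EB = mk⇔ to from
  where
  to : CliqueOn [ sa , sb ]′ (sumAdj EA EB) → CliqueOn sa EA × CliqueOn sb EB × Apart sa sb
  to h = onLeft , onRight , apart
    where
    onLeft : CliqueOn sa EA
    onLeft x y sx sy = Sum.map₁ inj₁-injective (h (inj₁ x) (inj₁ y) sx sy)
    onRight : CliqueOn sb EB
    onRight x y sx sy = Sum.map₁ inj₂-injective (h (inj₂ x) (inj₂ y) sx sy)
    apart : Apart sa sb
    apart x y sx sy with h (inj₁ x) (inj₂ y) sx sy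
    ... | inj₁ ()
    ... | inj₂ ()
  from : CliqueOn sa EA × CliqueOn sb EB × Apart sa sb → CliqueOn [ sa , sb ]′ (sumAdj EA EB)
  from (ca , cb , apart) (inj₁ x) (inj₁ y) sx sy = Sum.map₁ (cong inj₁) (ca x y sx sy)
  from (ca , cb , apart) (inj₁ x) (inj₂ y) sx sy = ⊥-elim (apart x y sx sy)
  from (ca , cb , apart) (inj₂ x) (inj₁ y) sx sy = ⊥-elim (apart y x sy sx)
  from (ca , cb , apart) (inj₂ x) (inj₂ y) sx sy = Sum.map₁ (cong inj₂) (cb x y sx sy)

Apart-lookup : ∀ {n m} (a : Subset n) (b : Subset m) → Apart (lookup a) (lookup b) ⇔ T (isEmpty a ∨ isEmpty b)
Apart-lookup a b = mk⇔ to from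
  where
  to : Apart (lookup a) (lookup b) → T (isEmpty a ∨ isEmpty b)
  to apart with emptyOrMember a | emptyOrMember b
  ... | inj₁ a-empty | _          = Equivalence.from T-∨ (inj₁ a-empty)
  ... | inj₂ _       | inj₁ b-empty = Equivalence.from T-∨ (inj₂ b-empty)
  ... | inj₂ (x , x∈a) | inj₂ (y , y∈b) = ⊥-elim (apart x y x∈a y∈b)
  from : T (isEmpty a ∨ isEmpty b) → Apart (lookup a) (lookup b)
  from e x y x∈a y∈b = [ (λ a-empty → isEmpty⇒∉ a a-empty x∈a) , (λ b-empty → isEmpty⇒∉ b b-empty y∈b) ]′
                         (Equivalence.to T-∨ e)

isClique-⊕ : ∀ G H (a : Subset (size G)) (b : Subset (size H)) →
  isClique (G ⊕ H) (a ++ b) ≡ isClique G a ∧ isClique H b ∧ (isEmpty a ∨ isEmpty b)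
isClique-⊕ G H a b = T-injective
  (⇔-trans (isClique-reflects (G ⊕ H) (a ++ b))
  (⇔-trans (CliqueOn-↔ +↔⊎ (lookup-splitAt (size G) a b) (λ _ _ → refl))
  (⇔-trans (CliqueOn-⊎ (lookup a) (lookup b) (adj G) (adj H))
  (⇔-sym (⇔-trans T-∧ (isClique-reflects G a ×-⇔
                        ⇔-trans T-∧ (isClique-reflects H b ×-⇔ ⇔-sym (Apart-lookup a b))))))))

prodAdj-reflexive : ∀ {n m} (EA : Fin n → Fin n → Bool) (EB : Fin m → Fin m → Bool) x y x′ y′ →
  ((x , y) ≡ (x′ , y′) ⊎ T (prodAdj EA EB (x , y) (x′ , y′)))
  ⇔ ((x ≡ x′ ⊎ T (EA x x′)) × (y ≡ y′ ⊎ T (EB y y′)))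
prodAdj-reflexive EA EB x y x′ y′ with x ≟ x′ | y ≟ y′
... | yes refl | yes refl = mk⇔ (λ _ → inj₁ refl , inj₁ refl) (λ _ → inj₁ refl)
... | yes refl | no y≢y′ = mk⇔
  [ (λ eq → inj₁ refl , inj₁ (cong proj₂ eq)) , (λ e → inj₁ refl , inj₂ e) ]′
  (λ (_ , e) → Sum.map₁ (cong (x ,_)) e)
... | no x≢x′ | yes refl = mk⇔
  [ (λ eq → inj₁ (cong proj₁ eq) , inj₁ refl) , (λ e → inj₂ (proj₁ (Equivalence.to T-∧ e)) , inj₁ refl) ]′
  (λ (e , _) → Sum.map (cong (_, y)) (λ ex → Equivalence.from T-∧ (ex , tt)) e)
... | no x≢x′ | no y≢y′ = mk⇔
  [ (λ eq → ⊥-elim (x≢x′ (cong proj₁ eq))) , (λ e → Product.map inj₂ inj₂ (Equivalence.to T-∧ e)) ]′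
  λ { (inj₁ x≡x′ , _) → ⊥-elim (x≢x′ x≡x′)
    ; (_ , inj₁ y≡y′) → ⊥-elim (y≢y′ y≡y′)
    ; (inj₂ ex , inj₂ ey) → inj₂ (Equivalence.from T-∧ (ex , ey)) }

CliqueOn-prodAdj : ∀ {n m} (R : Fin n × Fin m → Bool) (s₁ : Fin n → Bool) (s₂ : Fin m → Bool) EA EB →
  (∀ x → T (s₁ x) ⇔ (∃[ y ] T (R (x , y)))) → (∀ y → T (s₂ y) ⇔ (∃[ x ] T (R (x , y)))) →
  CliqueOn R (prodAdj EA EB) ⇔ (CliqueOn s₁ EA × CliqueOn s₂ EB)
CliqueOn-prodAdj R s₁ s₂ EA EB proj₁R proj₂R = mk⇔ to from
  where
  to : CliqueOn R (prodAdj EA EB) → CliqueOn s₁ EA × CliqueOn s₂ EB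
  to h = onFirst , onSecond
    where
    onFirst : CliqueOn s₁ EA
    onFirst x x′ sx sx′ =
      let y , r = Equivalence.to (proj₁R x) sx ; y′ , r′ = Equivalence.to (proj₁R x′) sx′
      in proj₁ (Equivalence.to (prodAdj-reflexive EA EB x y x′ y′) (h (x , y) (x′ , y′) r r′))
    onSecond : CliqueOn s₂ EB
    onSecond y y′ sy sy′ =
      let x , r = Equivalence.to (proj₂R y) sy ; x′ , r′ = Equivalence.to (proj₂R y′) sy′
      in proj₂ (Equivalence.to (prodAdj-reflexive EA EB x y x′ y′) (h (x , y) (x′ , y′) r r′))
  from : CliqueOn s₁ EA × CliqueOn s₂ EB → CliqueOn R (prodAdj EA EB)
  from (c₁ , c₂) (x , y) (x′ , y′) r r′ = Equivalence.from (prodAdj-reflexive EA EB x y x′ y′)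
    ( c₁ x x′ (Equivalence.from (proj₁R x) (y , r)) (Equivalence.from (proj₁R x′) (y′ , r′))
    , c₂ y y′ (Equivalence.from (proj₂R y) (x , r)) (Equivalence.from (proj₂R y′) (x′ , r′)))

isClique-⊠ : ∀ G H (rs : Vec (Subset (size H)) (size G)) →
  isClique (G ⊠ H) (concat rs) ≡ isClique G (support rs) ∧ isClique H (⋃ rs)
isClique-⊠ G H rs = T-injective
  (⇔-trans (isClique-reflects (G ⊠ H) (concat rs))
  (⇔-trans (CliqueOn-↔ *↔× lookup-concat-remQuot (λ _ _ → refl))
  (⇔-trans (CliqueOn-prodAdj R (lookup (support rs)) (lookup (⋃ rs)) (adj G) (adj H) in-support (T-lookup-⋃ rs))
  (⇔-sym (⇔-trans T-∧ (isClique-reflects G (support rs) ×-⇔ isClique-reflects H (⋃ rs)))))))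
  where
  R : Fin (size G) × Fin (size H) → Bool
  R (x , y) = lookup (lookup rs x) y
  lookup-concat-remQuot : ∀ i → lookup (concat rs) i ≡ R (remQuot (size H) i)
  lookup-concat-remQuot i = trans (cong (lookup (concat rs)) (sym (combine-remQuot {size G} (size H) i))) (lookup-concat rs _ _)
  in-support : ∀ x → T (lookup (support rs) x) ⇔ (∃[ y ] T (R (x , y)))
  in-support x = ⇔-trans (mk⇔ (subst T (lookup-map x nonempty rs)) (subst T (sym (lookup-map x nonempty rs))))
                         (T-nonempty (lookup rs x))

-- The Euler characteristic as a signed clique count

countᵇ-++ : ∀ {A : Set} (p : A → Bool) xs ys → countᵇ p (xs List.++ ys) ≡ countᵇ p xs ℕ.+ countᵇ p ys
countᵇ-++ p []       ys = refl
countᵇ-++ p (x ∷ xs) ys with p x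
... | true  = cong suc (countᵇ-++ p xs ys)
... | false = countᵇ-++ p xs ys

countᵇ-map : ∀ {A B : Set} (p : B → Bool) (f : A → B) xs → countᵇ p (List.map f xs) ≡ countᵇ (p ∘ f) xs
countᵇ-map p f []       = refl
countᵇ-map p f (x ∷ xs) with p (f x)
... | true  = cong suc (countᵇ-map p f xs)
... | false = countᵇ-map p f xs

countᵇ-subsets : ∀ n (p : Subset n → Bool) → + countᵇ p (subsets n) ≡ ∑ n (𝟙 ∘ p)
countᵇ-subsets zero    p with p []
... | true  = refl
... | false = refl
countᵇ-subsets (suc n) p = begin
  + countᵇ p (withInside List.++ withOutside)
    ≡⟨ cong +_ (countᵇ-++ p withInside withOutside) ⟩
  + (countᵇ p withInside ℕ.+ countᵇ p withOutside)
    ≡⟨ pos-+ (countᵇ p withInside) (countᵇ p withOutside) ⟩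
  + countᵇ p withInside + + countᵇ p withOutside
    ≡⟨ cong₂ _+_ (trans (cong +_ (countᵇ-map p (inside ∷_) (subsets n))) (countᵇ-subsets n (p ∘ (inside ∷_))))
                 (trans (cong +_ (countᵇ-map p (outside ∷_) (subsets n))) (countᵇ-subsets n (p ∘ (outside ∷_)))) ⟩
  ∑ (suc n) (𝟙 ∘ p) ∎
  where
  withInside withOutside : List (Subset (suc n))
  withInside  = List.map (inside ∷_) (subsets n)
  withOutside = List.map (outside ∷_) (subsets n)

v≡∑ : ∀ k G → + v k G ≡ ∑ (size G) (λ s → 𝟙 (isClique G s) * 𝟙 (card s ≡ᵇ suc k))
v≡∑ k G = trans (countᵇ-subsets (size G) _) (∑-cong (size G) (λ s → 𝟙-∧ (isClique G s) (card s ≡ᵇ suc k)))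

-- The coefficient of a j-element subset in the truncated sum Σ_{k<N} (-1)^k v_k.
eulerWeight : ℕ → ℕ → ℤ
eulerWeight zero    j = 0ℤ
eulerWeight (suc N) j = eulerWeight N j + sign N * 𝟙 (j ≡ᵇ suc N)

≢⇒≡ᵇ-false : ∀ j k → j ≢ k → (j ≡ᵇ k) ≡ false
≢⇒≡ᵇ-false j k j≢k with j ≡ᵇ k in eq
... | false = refl
... | true  = ⊥-elim (j≢k (≡ᵇ⇒≡ j k (subst T (sym eq) tt)))

eulerWeight-> : ∀ N j → N < j → eulerWeight N j ≡ 0ℤ
eulerWeight-> zero    j _   = refl
eulerWeight-> (suc N) j N<j
  rewrite ≢⇒≡ᵇ-false j (suc N) (≢-sym (<⇒≢ N<j)) | eulerWeight-> N j (<⇒≤ N<j) =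
  trans (+-identityˡ (sign N * 0ℤ)) (*-zeroʳ (sign N))

eulerWeight-≤ : ∀ N j → j ≤ N → eulerWeight N j ≡ 𝟙 (j ≡ᵇ 0) - sign j
eulerWeight-≤ zero    zero    z≤n = refl
eulerWeight-≤ (suc N) j j≤N with m≤n⇒m<n∨m≡n j≤N
... | inj₁ (s≤s j≤N′) rewrite ≢⇒≡ᵇ-false j (suc N) (<⇒≢ (s≤s j≤N′)) | eulerWeight-≤ N j j≤N′ =
  trans (cong (_+_ (𝟙 (j ≡ᵇ 0) - sign j)) (*-zeroʳ (sign N))) (+-identityʳ _)
... | inj₂ refl rewrite eulerWeight-> N (suc N) ≤-refl | Equivalence.to T-≡ (≡⇒≡ᵇ N N refl) =
  last-term (sign N)
  where
  last-term : ∀ a → 0ℤ + a * 1ℤ ≡ 0ℤ - (- a)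
  last-term = solve-∀

partialχ≡∑ : ∀ G N → partialχ G N ≡ ∑ (size G) (λ s → 𝟙 (isClique G s) * eulerWeight N (card s))
partialχ≡∑ G zero    = sym (trans (∑-cong (size G) (λ s → *-zeroʳ (𝟙 (isClique G s)))) (∑-zero (size G)))
partialχ≡∑ G (suc N) = begin
  partialχ G N + sign N * + v N G
    ≡⟨ cong₂ (λ x y → x + sign N * y) (partialχ≡∑ G N) (v≡∑ N G) ⟩
  ∑ n earlier + sign N * ∑ n newest
    ≡⟨ cong (_+_ (∑ n earlier)) (sym (∑-distribˡ-* n (sign N) newest)) ⟩
  ∑ n earlier + ∑ n (λ s → sign N * newest s)
    ≡⟨ sym (∑-distrib-+ n earlier (λ s → sign N * newest s)) ⟩
  ∑ n (λ s → earlier s + sign N * newest s)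
    ≡⟨ ∑-cong n (λ s → collect (𝟙 (isClique G s)) (eulerWeight N (card s)) (sign N) (𝟙 (card s ≡ᵇ suc N))) ⟩
  ∑ n (λ s → 𝟙 (isClique G s) * eulerWeight (suc N) (card s)) ∎
  where
  n = size G
  earlier newest : Subset n → ℤ
  earlier s = 𝟙 (isClique G s) * eulerWeight N (card s)
  newest  s = 𝟙 (isClique G s) * 𝟙 (card s ≡ᵇ suc N)
  collect : ∀ c w σ e → c * w + σ * (c * e) ≡ c * (w + σ * e)
  collect = solve-∀

card≤ : ∀ {n} (s : Subset n) → card s ≤ n
card≤ []            = z≤n
card≤ (inside ∷ s)  = s≤s (card≤ s)
card≤ (outside ∷ s) = m≤n⇒m≤1+n (card≤ s)

cliqueSum : Graph → ℤ
cliqueSum G = signedSum (size G) (𝟙 ∘ isClique G)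

sgn*𝟙-∅ : ∀ G → sgn (∅ {size G}) * 𝟙 (isClique G ∅) ≡ 1ℤ
sgn*𝟙-∅ G rewrite sgn-∅ (size G) | ∅-isClique G = refl

χG≡1-cliqueSum : ∀ G → χG G ≡ 1ℤ - cliqueSum G
χG≡1-cliqueSum G = begin
  partialχ G (suc n)
    ≡⟨ partialχ≡∑ G (suc n) ⟩
  ∑ n (λ s → 𝟙 (isClique G s) * eulerWeight (suc n) (card s))
    ≡⟨ ∑-cong n (λ s → cong (𝟙 (isClique G s) *_) (eulerWeight-≤ (suc n) (card s) (m≤n⇒m≤1+n (card≤ s)))) ⟩
  ∑ n (λ s → 𝟙 (isClique G s) * (𝟙 (isEmpty s) - sgn s))
    ≡⟨ ∑-cong n (λ s → expand (𝟙 (isClique G s)) (𝟙 (isEmpty s)) (sgn s)) ⟩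
  ∑ n (λ s → 1ℤ * (𝟙 (isEmpty s) * 𝟙 (isClique G s)) + (- 1ℤ) * (sgn s * 𝟙 (isClique G s)))
    ≡⟨ ∑-linear n 1ℤ (- 1ℤ) _ _ ⟩
  1ℤ * ∑ n (λ s → 𝟙 (isEmpty s) * 𝟙 (isClique G s)) + (- 1ℤ) * cliqueSum G
    ≡⟨ cong (λ x → 1ℤ * x + (- 1ℤ) * cliqueSum G)
            (trans (∑-empty n (𝟙 ∘ isClique G)) (cong 𝟙 (∅-isClique G))) ⟩
  1ℤ * 1ℤ + (- 1ℤ) * cliqueSum G
    ≡⟨ tidy (cliqueSum G) ⟩
  1ℤ - cliqueSum G ∎
  where
  n = size G
  expand : ∀ c e σ → c * (e - σ) ≡ 1ℤ * (e * c) + (- 1ℤ) * (σ * c)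
  expand = solve-∀
  tidy : ∀ w → 1ℤ * 1ℤ + (- 1ℤ) * w ≡ 1ℤ - w
  tidy = solve-∀

cliqueSum-⊕ : ∀ G H → cliqueSum (G ⊕ H) ≡ cliqueSum G + cliqueSum H - 1ℤ
cliqueSum-⊕ G H = begin
  ∑ (n ℕ.+ m) (λ s → sgn s * 𝟙 (isClique (G ⊕ H) s))
    ≡⟨ ∑-++ n m _ ⟩
  ∑ n (λ a → ∑ m (λ b → sgn (a ++ b) * 𝟙 (isClique (G ⊕ H) (a ++ b))))
    ≡⟨ ∑-cong n (λ a → ∑-cong m (λ b → term a b)) ⟩
  ∑ n (λ a → ∑ m (λ b → A a * ((1ℤ - 𝟙 (isEmpty a)) * (𝟙 (isEmpty b) * B b) + 𝟙 (isEmpty a) * B b)))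
    ≡⟨ ∑-cong n (λ a → trans (∑-distribˡ-* m (A a) _) (cong (A a *_) (inner a))) ⟩
  ∑ n (λ a → A a * ((1ℤ - 𝟙 (isEmpty a)) * 1ℤ + 𝟙 (isEmpty a) * cliqueSum H))
    ≡⟨ ∑-cong n (λ a → regroup (A a) (𝟙 (isEmpty a)) (cliqueSum H)) ⟩
  ∑ n (λ a → 1ℤ * A a + (cliqueSum H - 1ℤ) * (𝟙 (isEmpty a) * A a))
    ≡⟨ ∑-linear n 1ℤ (cliqueSum H - 1ℤ) A _ ⟩
  1ℤ * cliqueSum G + (cliqueSum H - 1ℤ) * ∑ n (λ a → 𝟙 (isEmpty a) * A a)
    ≡⟨ cong (λ x → 1ℤ * cliqueSum G + (cliqueSum H - 1ℤ) * x) (trans (∑-empty n A) (sgn*𝟙-∅ G)) ⟩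
  1ℤ * cliqueSum G + (cliqueSum H - 1ℤ) * 1ℤ
    ≡⟨ tidy (cliqueSum G) (cliqueSum H) ⟩
  cliqueSum G + cliqueSum H - 1ℤ ∎
  where
  n = size G
  m = size H
  A : Subset n → ℤ
  A a = sgn a * 𝟙 (isClique G a)
  B : Subset m → ℤ
  B b = sgn b * 𝟙 (isClique H b)

  term : ∀ a b → sgn (a ++ b) * 𝟙 (isClique (G ⊕ H) (a ++ b))
               ≡ A a * ((1ℤ - 𝟙 (isEmpty a)) * (𝟙 (isEmpty b) * B b) + 𝟙 (isEmpty a) * B b)
  term a b = begin
    sgn (a ++ b) * 𝟙 (isClique (G ⊕ H) (a ++ b))
      ≡⟨ cong₂ _*_ (sgn-++ a b) (cong 𝟙 (isClique-⊕ G H a b)) ⟩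
    sgn a * sgn b * 𝟙 (isClique G a ∧ isClique H b ∧ (isEmpty a ∨ isEmpty b))
      ≡⟨ cong (sgn a * sgn b *_) (trans (𝟙-∧ (isClique G a) _) (cong (𝟙 (isClique G a) *_)
           (trans (𝟙-∧ (isClique H b) _) (cong (𝟙 (isClique H b) *_) (𝟙-∨ (isEmpty a) (isEmpty b)))))) ⟩
    sgn a * sgn b * (𝟙 (isClique G a) * (𝟙 (isClique H b) *
                     (𝟙 (isEmpty a) + 𝟙 (isEmpty b) - 𝟙 (isEmpty a) * 𝟙 (isEmpty b))))
      ≡⟨ expand (sgn a) (sgn b) (𝟙 (isClique G a)) (𝟙 (isClique H b)) (𝟙 (isEmpty a)) (𝟙 (isEmpty b)) ⟩
    A a * ((1ℤ - 𝟙 (isEmpty a)) * (𝟙 (isEmpty b) * B b) + 𝟙 (isEmpty a) * B b) ∎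
    where
    expand : ∀ σ τ c d e f → σ * τ * (c * (d * (e + f - e * f))) ≡ σ * c * ((1ℤ - e) * (f * (τ * d)) + e * (τ * d))
    expand = solve-∀

  inner : ∀ a → ∑ m (λ b → (1ℤ - 𝟙 (isEmpty a)) * (𝟙 (isEmpty b) * B b) + 𝟙 (isEmpty a) * B b)
              ≡ (1ℤ - 𝟙 (isEmpty a)) * 1ℤ + 𝟙 (isEmpty a) * cliqueSum H
  inner a = trans (∑-linear m (1ℤ - 𝟙 (isEmpty a)) (𝟙 (isEmpty a)) (λ b → 𝟙 (isEmpty b) * B b) B)
                  (cong (λ x → (1ℤ - 𝟙 (isEmpty a)) * x + 𝟙 (isEmpty a) * cliqueSum H)
                        (trans (∑-empty m B) (sgn*𝟙-∅ H)))

  regroup : ∀ x e w → x * ((1ℤ - e) * 1ℤ + e * w) ≡ 1ℤ * x + (w - 1ℤ) * (e * x)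
  regroup = solve-∀
  tidy : ∀ g h → 1ℤ * g + (h - 1ℤ) * 1ℤ ≡ g + h - 1ℤ
  tidy = solve-∀

cliqueSum-⊠ : ∀ G H → cliqueSum (G ⊠ H) ≡ cliqueSum G + cliqueSum H - cliqueSum G * cliqueSum H
cliqueSum-⊠ G H = begin
  ∑ (n ℕ.* m) (λ s → sgn s * 𝟙 (isClique (G ⊠ H) s))
    ≡⟨ ∑-concat n m _ ⟩
  ∑ᴿ n m (λ rs → sgn (concat rs) * 𝟙 (isClique (G ⊠ H) (concat rs)))
    ≡⟨ ∑ᴿ-cong n m (λ rs → cong (sgn (concat rs) *_) (term rs)) ⟩
  ∑ᴿ n m (λ rs → sgn (concat rs) * (𝟙 (isClique G (support rs)) * 𝟙 (isClique H (∅ ∪ ⋃ rs))))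
    ≡⟨ ∑ᴿ-support-⋃ n m (𝟙 ∘ isClique G) (𝟙 ∘ isClique H) ∅ ⟩
  cliqueSum G * 𝟙 (isClique H ∅) - 𝟙 (isEmpty (∅ {m})) * ((cliqueSum G - 𝟙 (isClique G ∅)) * cliqueSum H)
    ≡⟨ at-∅ ⟩
  cliqueSum G * 1ℤ - 1ℤ * ((cliqueSum G - 1ℤ) * cliqueSum H)
    ≡⟨ tidy (cliqueSum G) (cliqueSum H) ⟩
  cliqueSum G + cliqueSum H - cliqueSum G * cliqueSum H ∎
  where
  n = size G
  m = size H
  term : ∀ rs → 𝟙 (isClique (G ⊠ H) (concat rs)) ≡ 𝟙 (isClique G (support rs)) * 𝟙 (isClique H (∅ ∪ ⋃ rs))
  term rs = begin
    𝟙 (isClique (G ⊠ H) (concat rs))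
      ≡⟨ cong 𝟙 (isClique-⊠ G H rs) ⟩
    𝟙 (isClique G (support rs) ∧ isClique H (⋃ rs))
      ≡⟨ 𝟙-∧ (isClique G (support rs)) (isClique H (⋃ rs)) ⟩
    𝟙 (isClique G (support rs)) * 𝟙 (isClique H (⋃ rs))
      ≡⟨ cong (λ t → 𝟙 (isClique G (support rs)) * 𝟙 (isClique H t)) (sym (∪-identityˡ (⋃ rs))) ⟩
    𝟙 (isClique G (support rs)) * 𝟙 (isClique H (∅ ∪ ⋃ rs)) ∎
  at-∅ : cliqueSum G * 𝟙 (isClique H ∅) - 𝟙 (isEmpty (∅ {m})) * ((cliqueSum G - 𝟙 (isClique G ∅)) * cliqueSum H)
       ≡ cliqueSum G * 1ℤ - 1ℤ * ((cliqueSum G - 1ℤ) * cliqueSum H)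
  at-∅ rewrite ∅-isClique G | ∅-isClique H | ∅-isEmpty m = refl
  tidy : ∀ g h → g * 1ℤ - 1ℤ * ((g - 1ℤ) * h) ≡ g + h - g * h
  tidy = solve-∀

cliqueSum-Iso : ∀ {G H} → Iso G H → cliqueSum G ≡ cliqueSum H
cliqueSum-Iso {G} {H} iso = sym (begin
  ∑ (size H) (λ t → sgn t * 𝟙 (isClique H t))
    ≡⟨ ∑-relabel (size G) (size H) σ _ ⟩
  ∑ (size G) (λ s → sgn (relabel σ s) * 𝟙 (isClique H (relabel σ s)))
    ≡⟨ ∑-cong (size G) (λ s → cong₂ _*_ (sgn-relabel (size G) (size H) σ s) (cong 𝟙 (isClique-relabel iso s))) ⟩
  ∑ (size G) (λ s → sgn s * 𝟙 (isClique G s)) ∎)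
  where σ = Iso.bij iso

χG-⊕ : ∀ G H → χG (G ⊕ H) ≡ χG G + χG H
χG-⊕ G H = begin
  χG (G ⊕ H)                                  ≡⟨ χG≡1-cliqueSum (G ⊕ H) ⟩
  1ℤ - cliqueSum (G ⊕ H)                      ≡⟨ cong (_-_ 1ℤ) (cliqueSum-⊕ G H) ⟩
  1ℤ - (cliqueSum G + cliqueSum H - 1ℤ)        ≡⟨ split (cliqueSum G) (cliqueSum H) ⟩
  (1ℤ - cliqueSum G) + (1ℤ - cliqueSum H)      ≡⟨ sym (cong₂ _+_ (χG≡1-cliqueSum G) (χG≡1-cliqueSum H)) ⟩
  χG G + χG H ∎
  where
  split : ∀ g h → 1ℤ - (g + h - 1ℤ) ≡ (1ℤ - g) + (1ℤ - h)
  split = solve-∀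

χG-⊠ : ∀ G H → χG (G ⊠ H) ≡ χG G * χG H
χG-⊠ G H = begin
  χG (G ⊠ H)                                                    ≡⟨ χG≡1-cliqueSum (G ⊠ H) ⟩
  1ℤ - cliqueSum (G ⊠ H)                                        ≡⟨ cong (_-_ 1ℤ) (cliqueSum-⊠ G H) ⟩
  1ℤ - (cliqueSum G + cliqueSum H - cliqueSum G * cliqueSum H)   ≡⟨ factor (cliqueSum G) (cliqueSum H) ⟩
  (1ℤ - cliqueSum G) * (1ℤ - cliqueSum H)                        ≡⟨ sym (cong₂ _*_ (χG≡1-cliqueSum G) (χG≡1-cliqueSum H)) ⟩
  χG G * χG H ∎
  where
  factor : ∀ g h → 1ℤ - (g + h - g * h) ≡ (1ℤ - g) * (1ℤ - h)
  factor = solve-∀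

χG-Iso : ∀ {G H} → Iso G H → χG G ≡ χG H
χG-Iso {G} {H} iso = begin
  χG G              ≡⟨ χG≡1-cliqueSum G ⟩
  1ℤ - cliqueSum G  ≡⟨ cong (_-_ 1ℤ) (cliqueSum-Iso iso) ⟩
  1ℤ - cliqueSum H  ≡⟨ sym (χG≡1-cliqueSum H) ⟩
  χG H ∎

-- The strong ring

χ-cong : ∀ X Y → X ≈SR Y → χ X ≡ χ Y
χ-cong (A , B) (C , D) (K , iso) = begin
  χG A - χG B                                               ≡⟨ cancel (χG A) (χG B) (χG C) (χG D) (χG K) ⟩
  (χG A + χG D + χG K) - (χG B + χG D + χG K)               ≡⟨ cong (_- (χG B + χG D + χG K)) sums-agree ⟩
  (χG B + χG C + χG K) - (χG B + χG D + χG K)               ≡⟨ cancel′ (χG B) (χG C) (χG D) (χG K) ⟩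
  χG C - χG D ∎
  where
  χG-⊕³ : ∀ P Q R → χG (P ⊕ Q ⊕ R) ≡ χG P + χG Q + χG R
  χG-⊕³ P Q R = trans (χG-⊕ (P ⊕ Q) R) (cong (_+ χG R) (χG-⊕ P Q))
  sums-agree : χG A + χG D + χG K ≡ χG B + χG C + χG K
  sums-agree = trans (sym (χG-⊕³ A D K)) (trans (χG-Iso iso) (χG-⊕³ B C K))
  cancel : ∀ a b c d k → a - b ≡ (a + d + k) - (b + d + k)
  cancel = solve-∀
  cancel′ : ∀ b c d k → (b + c + k) - (b + d + k) ≡ c - d
  cancel′ = solve-∀

χ-⊕ : ∀ X Y → χ (X ⊕SR Y) ≡ χ X + χ Y
χ-⊕ (A , B) (C , D) = begin
  χG (A ⊕ C) - χG (B ⊕ D)               ≡⟨ cong₂ _-_ (χG-⊕ A C) (χG-⊕ B D) ⟩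
  (χG A + χG C) - (χG B + χG D)         ≡⟨ regroup (χG A) (χG B) (χG C) (χG D) ⟩
  (χG A - χG B) + (χG C - χG D) ∎
  where
  regroup : ∀ a b c d → (a + c) - (b + d) ≡ (a - b) + (c - d)
  regroup = solve-∀

χ-⊠ : ∀ X Y → χ (X ⊠SR Y) ≡ χ X * χ Y
χ-⊠ (A , B) (C , D) = begin
  χG (A ⊠ C ⊕ B ⊠ D) - χG (A ⊠ D ⊕ B ⊠ C)
    ≡⟨ cong₂ _-_ (trans (χG-⊕ (A ⊠ C) (B ⊠ D)) (cong₂ _+_ (χG-⊠ A C) (χG-⊠ B D)))
                 (trans (χG-⊕ (A ⊠ D) (B ⊠ C)) (cong₂ _+_ (χG-⊠ A D) (χG-⊠ B C))) ⟩
  (χG A * χG C + χG B * χG D) - (χG A * χG D + χG B * χG C)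
    ≡⟨ factor (χG A) (χG B) (χG C) (χG D) ⟩
  (χG A - χG B) * (χG C - χG D) ∎
  where
  factor : ∀ a b c d → (a * c + b * d) - (a * d + b * c) ≡ (a - b) * (c - d)
  factor = solve-∀

mainTheorem3 : (∀ X Y → X ≈SR Y → χ X ≡ χ Y)
    × χ 0SR ≡ + 0
    × χ 1SR ≡ + 1
    × (∀ X Y → χ (X ⊕SR Y) ≡ χ X + χ Y)
    × (∀ X Y → χ (X ⊠SR Y) ≡ χ X * χ Y)
mainTheorem3 = χ-cong , +-inverseʳ (χG emptyG) , refl , χ-⊕ , χ-⊠
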